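{- The variety $\mathcal{SPO}$ of sp-orthomodular lattices is not the largest subvariety of the variety of pseudo-Kleene lattices having no member isomorphic to $\mathbf B_6$ or to $\mathbf B_8$; that is, there exists a subvariety $\mathcal V$ of pseudo-Kleene lattices with no member isomorphic to $\mathbf B_6$ or $\mathbf B_8$ such that $\mathcal V\not\subseteq\mathcal{SPO}$.
   Context: A pseudo-Kleene lattice is an algebra $(A,\land,\lor,{}',0,1)$ with $(A,\land,\lor,0,1)$ a bounded lattice, ${}'$ an antitone involution, and $x\land x'\leq y\lor y'$. It is sp-orthomodular if for all $x,y$: (SP1) $x\leq y$ and $x'\land y=(x\land x')\lor(y\land y')$ imply $y\land(x\lor x')=x\lor(y\land y')$; (SP2) $x\leq y$ implies $(x\land x')\lor(y\land y')=(x'\land y)\land(x'\land y)'$. $\mathbf B_6$: elements $0,x,y,y',x',1$, covers $0<x<y<1$, $0<y'<x'<1$, involution $0\leftrightarrow1$, $x\leftrightarrow x'$, $y\leftrightarrow y'$. $\mathbf B_8$: elements $0,z',x,y,y',x',z,1$, covers $0<z'$, $z'<x<y<z$, $z'<y'<x'<z$, $z<1$, involution $0\leftrightarrow1$, $x\leftrightarrow x'$, $y\leftrightarrow y'$, $z\leftrightarrow z'$. -}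

module Defs where

open import Data.Nat using (ℕ)
open import Data.Product using (_×_; _,_; Σ)
open import Relation.Binary.PropositionalEquality using (_≡_)
open import Algebra.Lattice.Structures using (IsLattice)
open import Relation.Unary using (Pred)
open import Level using (0ℓ)

record Alg : Set₁ where
  field
    Carrier : Set
    _∧_     : Carrier → Carrier → Carrier
    _∨_     : Carrier → Carrier → Carrier
    _′      : Carrier → Carrier
    ⊥a      : Carrier
    ⊤a      : Carrier
  infixr 7 _∧_
  infixr 6 _∨_
  infix 8 _′
  infix 4 _≤_

  _≤_ : Carrier → Carrier → Set
  x ≤ y = x ∧ y ≡ x

record IsPKL (A : Alg) : Set where
  open Alg A
  field
    isLattice  : IsLattice _≡_ _∨_ _∧_
    ⊥-least    : ∀ x → ⊥a ≤ x
    ⊤-greatest : ∀ x → x ≤ ⊤a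
    involutive : ∀ x → (x ′) ′ ≡ x
    antitone   : ∀ x y → x ≤ y → y ′ ≤ x ′
    kleene     : ∀ x y → (x ∧ x ′) ≤ (y ∨ y ′)

record IsSPO (A : Alg) : Set where
  open Alg A
  field
    isPKL : IsPKL A
    SP1   : ∀ x y → x ≤ y → x ′ ∧ y ≡ (x ∧ x ′) ∨ (y ∧ y ′)
                  → y ∧ (x ∨ x ′) ≡ x ∨ (y ∧ y ′)
    SP2   : ∀ x y → x ≤ y
                  → (x ∧ x ′) ∨ (y ∧ y ′) ≡ (x ′ ∧ y) ∧ (x ′ ∧ y) ′

record _≅_ (A B : Alg) : Set where
  private
    module A = Alg A
    module B = Alg B
  field
    to       : A.Carrier → B.Carrier
    from     : B.Carrier → A.Carrier
    from-to  : ∀ a → from (to a) ≡ a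
    to-from  : ∀ b → to (from b) ≡ b
    pres-∧   : ∀ a b → to (a A.∧ b) ≡ to a B.∧ to b
    pres-∨   : ∀ a b → to (a A.∨ b) ≡ to a B.∨ to b
    pres-′   : ∀ a → to (a A.′) ≡ (to a) B.′
    pres-⊥   : to A.⊥a ≡ B.⊥a
    pres-⊤   : to A.⊤a ≡ B.⊤a

data Term : Set where
  var  : ℕ → Term
  _∧ₜ_ : Term → Term → Term
  _∨ₜ_ : Term → Term → Term
  _′ₜ  : Term → Term
  ⊥ₜ   : Term
  ⊤ₜ   : Term

⟦_⟧ : Term → (A : Alg) → (ℕ → Alg.Carrier A) → Alg.Carrier A
⟦ var i  ⟧ A ρ = ρ i
⟦ s ∧ₜ t ⟧ A ρ = Alg._∧_ A (⟦ s ⟧ A ρ) (⟦ t ⟧ A ρ)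
⟦ s ∨ₜ t ⟧ A ρ = Alg._∨_ A (⟦ s ⟧ A ρ) (⟦ t ⟧ A ρ)
⟦ t ′ₜ   ⟧ A ρ = Alg._′ A (⟦ t ⟧ A ρ)
⟦ ⊥ₜ     ⟧ A ρ = Alg.⊥a A
⟦ ⊤ₜ     ⟧ A ρ = Alg.⊤a A

Identity : Set
Identity = Term × Term

_⊨_ : Alg → Pred Identity 0ℓ → Set
A ⊨ E = ∀ s t → E (s , t) → ∀ (ρ : ℕ → Alg.Carrier A) → ⟦ s ⟧ A ρ ≡ ⟦ t ⟧ A ρ

data E6 : Set where
  o x y y' x' i : E6

B6 : Alg
B6 = record { Carrier = E6 ; _∧_ = m ; _∨_ = j ; _′ = n ; ⊥a = o ; ⊤a = i }
  where
  m : E6 → E6 → E6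
  m o _ = o
  m i a = a
  m _ o = o
  m a i = a
  m x x = x
  m x y = x
  m y x = x
  m y y = y
  m y' y' = y'
  m y' x' = y'
  m x' y' = y'
  m x' x' = x'
  m _ _ = o
  j : E6 → E6 → E6
  j i _ = i
  j o a = a
  j _ i = i
  j a o = a
  j x x = x
  j x y = y
  j y x = y
  j y y = y
  j y' y' = y'
  j y' x' = x'
  j x' y' = x'
  j x' x' = x'
  j _ _ = i
  n : E6 → E6
  n o = i
  n i = o
  n x = x'
  n x' = x
  n y = y'
  n y' = y

data E8 : Set where
  o z' x y y' x' z i : E8

B8 : Alg
B8 = record { Carrier = E8 ; _∧_ = m ; _∨_ = j ; _′ = n ; ⊥a = o ; ⊤a = i }
  where
  m : E8 → E8 → E8
  m o _ = o
  m i a = a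
  m _ o = o
  m a i = a
  m z' _ = z'
  m _ z' = z'
  m z a = a
  m a z = a
  m x x = x
  m x y = x
  m y x = x
  m y y = y
  m y' y' = y'
  m y' x' = y'
  m x' y' = y'
  m x' x' = x'
  m _ _ = z'
  j : E8 → E8 → E8
  j i _ = i
  j o a = a
  j _ i = i
  j a o = a
  j z _ = z
  j _ z = z
  j z' a = a
  j a z' = a
  j x x = x
  j x y = y
  j y x = y
  j y y = y
  j y' y' = y'
  j y' x' = x'
  j x' y' = x'
  j x' x' = x'
  j _ _ = z
  n : E8 → E8
  n o = i
  n i = o
  n x = x'
  n x' = x
  n y = y'
  n y' = y
  n z = z'
  n z' = z

-- The variety is axiomatised by the identities of pseudo-Kleene lattices and the one identity
--   ((x′ ∧ x) ∨ (x ∧ y)) ∨ ((x′ ∨ y) ∧ (x′ ∨ y′)) = x′ ∨ (x ∧ y),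
-- which fails in B6 and in B8 at x := y, y := x′. Satisfaction of identities is invariant under
-- isomorphism, so no member is isomorphic to B6 or B8. The eight-element algebra C₈ satisfies
-- all these identities (checked by exhaustive evaluation) but violates SP2 at a ≤ c′:
-- (a ∧ a′) ∨ (c′ ∧ c) = a, whereas (a′ ∧ c′) ∧ (a′ ∧ c′)′ = b ∧ b′ = b.

module Submission where

open import Defs
open import Level using (0ℓ)
open import Data.Product using (_×_; Σ; ∃; _,_)
open import Relation.Nullary using (¬_)
open import Relation.Unary using (Pred)
open import Data.Nat using (ℕ; zero; suc)
open import Data.Fin using (Fin; _≟_)
open import Data.Fin.Properties using (all?)
open import Relation.Nullary.Decidable using (Dec; from-yes)
open import Relation.Binary.PropositionalEquality

⟦⟧-cong : ∀ A t {ρ σ : ℕ → Alg.Carrier A} → (∀ n → ρ n ≡ σ n) → ⟦ t ⟧ A ρ ≡ ⟦ t ⟧ A σ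
⟦⟧-cong A (var n)  ρ≗σ = ρ≗σ n
⟦⟧-cong A (s ∧ₜ t) ρ≗σ = cong₂ (Alg._∧_ A) (⟦⟧-cong A s ρ≗σ) (⟦⟧-cong A t ρ≗σ)
⟦⟧-cong A (s ∨ₜ t) ρ≗σ = cong₂ (Alg._∨_ A) (⟦⟧-cong A s ρ≗σ) (⟦⟧-cong A t ρ≗σ)
⟦⟧-cong A (t ′ₜ)   ρ≗σ = cong (Alg._′ A) (⟦⟧-cong A t ρ≗σ)
⟦⟧-cong A ⊥ₜ       ρ≗σ = refl
⟦⟧-cong A ⊤ₜ       ρ≗σ = refl

module _ {A B : Alg} (φ : A ≅ B) where
  open _≅_ φ

  to-⟦⟧ : ∀ t (ρ : ℕ → Alg.Carrier A) → to (⟦ t ⟧ A ρ) ≡ ⟦ t ⟧ B (λ n → to (ρ n))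
  to-⟦⟧ (var n)  ρ = refl
  to-⟦⟧ (s ∧ₜ t) ρ = trans (pres-∧ _ _) (cong₂ (Alg._∧_ B) (to-⟦⟧ s ρ) (to-⟦⟧ t ρ))
  to-⟦⟧ (s ∨ₜ t) ρ = trans (pres-∨ _ _) (cong₂ (Alg._∨_ B) (to-⟦⟧ s ρ) (to-⟦⟧ t ρ))
  to-⟦⟧ (t ′ₜ)   ρ = trans (pres-′ _) (cong (Alg._′ B) (to-⟦⟧ t ρ))
  to-⟦⟧ ⊥ₜ       ρ = pres-⊥
  to-⟦⟧ ⊤ₜ       ρ = pres-⊤

  ⊨-resp-≅ : {E : Pred Identity 0ℓ} → A ⊨ E → B ⊨ E
  ⊨-resp-≅ A⊨E s t st∈E ρ = begin
    ⟦ s ⟧ B ρ                 ≡⟨ ⟦⟧-cong B s (λ n → to-from (ρ n)) ⟨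
    ⟦ s ⟧ B (λ n → to (ρ′ n)) ≡⟨ to-⟦⟧ s ρ′ ⟨
    to (⟦ s ⟧ A ρ′)           ≡⟨ cong to (A⊨E s t st∈E ρ′) ⟩
    to (⟦ t ⟧ A ρ′)           ≡⟨ to-⟦⟧ t ρ′ ⟩
    ⟦ t ⟧ B (λ n → to (ρ′ n)) ≡⟨ ⟦⟧-cong B t (λ n → to-from (ρ n)) ⟩
    ⟦ t ⟧ B ρ                 ∎
    where
    open ≡-Reasoning
    ρ′ : ℕ → Alg.Carrier A
    ρ′ n = from (ρ n)

v₀ v₁ v₂ : Term
v₀ = var 0
v₁ = var 1
v₂ = var 2

data Axiom : Pred Identity 0ℓ where
  ∨-comm      : Axiom (v₀ ∨ₜ v₁ , v₁ ∨ₜ v₀)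
  ∧-comm      : Axiom (v₀ ∧ₜ v₁ , v₁ ∧ₜ v₀)
  ∨-assoc     : Axiom ((v₀ ∨ₜ v₁) ∨ₜ v₂ , v₀ ∨ₜ (v₁ ∨ₜ v₂))
  ∧-assoc     : Axiom ((v₀ ∧ₜ v₁) ∧ₜ v₂ , v₀ ∧ₜ (v₁ ∧ₜ v₂))
  ∨-absorbs-∧ : Axiom (v₀ ∨ₜ (v₀ ∧ₜ v₁) , v₀)
  ∧-absorbs-∨ : Axiom (v₀ ∧ₜ (v₀ ∨ₜ v₁) , v₀)
  ⊥-least     : Axiom (⊥ₜ ∧ₜ v₀ , ⊥ₜ)
  ⊤-greatest  : Axiom (v₀ ∧ₜ ⊤ₜ , v₀)
  involutive  : Axiom ((v₀ ′ₜ) ′ₜ , v₀)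
  antitone    : Axiom ((v₁ ′ₜ) ∧ₜ ((v₀ ∧ₜ v₁) ′ₜ) , v₁ ′ₜ)
  kleene      : Axiom ((v₀ ∧ₜ (v₀ ′ₜ)) ∧ₜ (v₁ ∨ₜ (v₁ ′ₜ)) , v₀ ∧ₜ (v₀ ′ₜ))
  separating  : Axiom ( (((v₀ ′ₜ) ∧ₜ v₀) ∨ₜ (v₀ ∧ₜ v₁)) ∨ₜ (((v₀ ′ₜ) ∨ₜ v₁) ∧ₜ ((v₀ ′ₜ) ∨ₜ (v₁ ′ₜ)))
                      , (v₀ ′ₜ) ∨ₜ (v₀ ∧ₜ v₁))

env₃ : {X : Set} → X → X → X → ℕ → X
env₃ u v w zero          = u
env₃ u v w (suc zero)    = v
env₃ u v w (suc (suc _)) = w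

Axiom⇒IsPKL : ∀ A → A ⊨ Axiom → IsPKL A
Axiom⇒IsPKL A ⊨ax = record
  { isLattice = record
      { isEquivalence = isEquivalence
      ; ∨-comm        = λ u v → holds ∨-comm u v u
      ; ∨-assoc       = holds ∨-assoc
      ; ∨-cong        = cong₂ _∨_
      ; ∧-comm        = λ u v → holds ∧-comm u v u
      ; ∧-assoc       = holds ∧-assoc
      ; ∧-cong        = cong₂ _∧_
      ; absorptive    = (λ u v → holds ∨-absorbs-∧ u v u) , (λ u v → holds ∧-absorbs-∨ u v u)
      }
  ; ⊥-least    = λ u → holds ⊥-least u u u
  ; ⊤-greatest = λ u → holds ⊤-greatest u u u
  ; involutive = λ u → holds involutive u u u
  ; antitone   = λ u v u≤v → trans (cong (λ w → v ′ ∧ w ′) (sym u≤v)) (holds antitone u v u)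
  ; kleene     = λ u v → holds kleene u v u
  }
  where
  open Alg A
  holds : ∀ {s t} → Axiom (s , t) → ∀ u v w → ⟦ s ⟧ A (env₃ u v w) ≡ ⟦ t ⟧ A (env₃ u v w)
  holds ax u v w = ⊨ax _ _ ax (env₃ u v w)

B6⊭Axiom : ¬ (B6 ⊨ Axiom)
B6⊭Axiom B6⊨ax with B6⊨ax _ _ separating (env₃ y x' x')
... | ()

B8⊭Axiom : ¬ (B8 ⊨ Axiom)
B8⊭Axiom B8⊨ax with B8⊨ax _ _ separating (env₃ y x' x')
... | ()

pattern 𝟎  = Fin.zero
pattern a  = Fin.suc 𝟎
pattern b  = Fin.suc a
pattern c  = Fin.suc b
pattern b′ = Fin.suc c
pattern a′ = Fin.suc b′
pattern c′ = Fin.suc a′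
pattern 𝟏  = Fin.suc c′

infix  8 _ᶜ
infixr 7 _⊓_
infixr 6 _⊔_

_ᶜ : Fin 8 → Fin 8
𝟎  ᶜ = 𝟏
a  ᶜ = a′
b  ᶜ = b′
c  ᶜ = c′
b′ ᶜ = b
a′ ᶜ = a
c′ ᶜ = c
𝟏  ᶜ = 𝟎

-- The chain 𝟎 < a < b < b′ < a′ < 𝟏, together with c below b′ and c′ above b,
-- where c ∧ b = 𝟎 and c′ ∨ b′ = 𝟏.
_⊓_ : Fin 8 → Fin 8 → Fin 8
𝟎  ⊓ _  = 𝟎
_  ⊓ 𝟎  = 𝟎
𝟏  ⊓ v  = v
u  ⊓ 𝟏  = u
c  ⊓ c  = c
c  ⊓ b′ = c
c  ⊓ a′ = c
b′ ⊓ c  = c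
a′ ⊓ c  = c
_  ⊓ c  = 𝟎
c  ⊓ _  = 𝟎
c′ ⊓ c′ = c′
c′ ⊓ a  = a
a  ⊓ c′ = a
c′ ⊓ _  = b
_  ⊓ c′ = b
a  ⊓ _  = a
_  ⊓ a  = a
b  ⊓ _  = b
_  ⊓ b  = b
b′ ⊓ _  = b′
_  ⊓ b′ = b′
a′ ⊓ a′ = a′

_⊔_ : Fin 8 → Fin 8 → Fin 8
u ⊔ v = (u ᶜ ⊓ v ᶜ) ᶜ

C₈ : Alg
C₈ = record { Carrier = Fin 8 ; _∧_ = _⊓_ ; _∨_ = _⊔_ ; _′ = _ᶜ ; ⊥a = 𝟎 ; ⊤a = 𝟏 }

valid-in-C₈ : Term → Term → Set
valid-in-C₈ s t = ∀ u v w → ⟦ s ⟧ C₈ (env₃ u v w) ≡ ⟦ t ⟧ C₈ (env₃ u v w)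

valid-in-C₈? : ∀ s t → Dec (valid-in-C₈ s t)
valid-in-C₈? s t = all? λ u → all? λ v → all? λ w → ⟦ s ⟧ C₈ (env₃ u v w) ≟ ⟦ t ⟧ C₈ (env₃ u v w)

-- All variables of an axiom are among v₀, v₁, v₂, so ⟦ s ⟧ C₈ ρ is definitionally
-- ⟦ s ⟧ C₈ (env₃ (ρ 0) (ρ 1) (ρ 2)).
C₈⊨Axiom : C₈ ⊨ Axiom
C₈⊨Axiom s t ∨-comm      ρ = from-yes (valid-in-C₈? s t) (ρ 0) (ρ 1) (ρ 2)
C₈⊨Axiom s t ∧-comm      ρ = from-yes (valid-in-C₈? s t) (ρ 0) (ρ 1) (ρ 2)
C₈⊨Axiom s t ∨-assoc     ρ = from-yes (valid-in-C₈? s t) (ρ 0) (ρ 1) (ρ 2)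
C₈⊨Axiom s t ∧-assoc     ρ = from-yes (valid-in-C₈? s t) (ρ 0) (ρ 1) (ρ 2)
C₈⊨Axiom s t ∨-absorbs-∧ ρ = from-yes (valid-in-C₈? s t) (ρ 0) (ρ 1) (ρ 2)
C₈⊨Axiom s t ∧-absorbs-∨ ρ = from-yes (valid-in-C₈? s t) (ρ 0) (ρ 1) (ρ 2)
C₈⊨Axiom s t ⊥-least     ρ = from-yes (valid-in-C₈? s t) (ρ 0) (ρ 1) (ρ 2)
C₈⊨Axiom s t ⊤-greatest  ρ = from-yes (valid-in-C₈? s t) (ρ 0) (ρ 1) (ρ 2)
C₈⊨Axiom s t involutive  ρ = from-yes (valid-in-C₈? s t) (ρ 0) (ρ 1) (ρ 2)
C₈⊨Axiom s t antitone    ρ = from-yes (valid-in-C₈? s t) (ρ 0) (ρ 1) (ρ 2)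
C₈⊨Axiom s t kleene      ρ = from-yes (valid-in-C₈? s t) (ρ 0) (ρ 1) (ρ 2)
C₈⊨Axiom s t separating  ρ = from-yes (valid-in-C₈? s t) (ρ 0) (ρ 1) (ρ 2)

C₈-not-SPO : ¬ IsSPO C₈
C₈-not-SPO spo with IsSPO.SP2 spo a c′ refl
... | ()

lemma4p4 : Σ (Pred Identity 0ℓ) λ E →
             (∀ (A : Alg) → A ⊨ E → IsPKL A)
           × (∀ (A : Alg) → A ⊨ E → ¬ (A ≅ B6) × ¬ (A ≅ B8))
           × ∃ λ (A : Alg) → A ⊨ E × ¬ IsSPO A
lemma4p4 = Axiom , Axiom⇒IsPKL , excludes-B6-B8 , C₈ , C₈⊨Axiom , C₈-not-SPO
  where
  excludes-B6-B8 : ∀ A → A ⊨ Axiom → ¬ (A ≅ B6) × ¬ (A ≅ B8)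
  excludes-B6-B8 A A⊨ax = (λ A≅B6 → B6⊭Axiom (⊨-resp-≅ A≅B6 A⊨ax))
                        , (λ A≅B8 → B8⊭Axiom (⊨-resp-≅ A≅B8 A⊨ax))
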